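{- Let $G$ be a connected graph. Then the following statements are equivalent: (C1) $G$ is $\{P_4, C_4\}$-free; (C2) every MNS ordering of $G$ is a LexDFS ordering of $G$; (C3) every MNS ordering of $G$ is a LexBFS ordering of $G$.
   Context: All graphs are finite and simple. For an ordering $\sigma$ of $V(G)$ write $x<_\sigma y$ if $x$ precedes $y$. In each of the following, the condition is required for all $a<_\sigma b<_\sigma c$ with $ac\in E(G)$ and $ab\notin E(G)$: $\sigma$ is a LexBFS ordering if there is $d$ with $d<_\sigma a$, $db\in E(G)$, $dc\notin E(G)$; a LexDFS ordering if there is $d$ with $a<_\sigma d<_\sigma b$, $db\in E(G)$, $dc\notin E(G)$; an MNS ordering if there is $d$ with $d<_\sigma b$, $db\in E(G)$, $dc\notin E(G)$. $\{P_4,C_4\}$-free means containing no induced path on 4 vertices and no induced 4-cycle. -}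

module Defs where

open import Data.Nat using (ℕ)
open import Data.Fin using (Fin; _<_)
open import Data.Product using (Σ; ∃; _×_; _,_)
open import Relation.Nullary using (¬_)
open import Relation.Binary using (Decidable)
open import Relation.Binary.PropositionalEquality using (_≡_; _≢_)
open import Function.Bundles using (_↔_; Inverse)
open import Level using (0ℓ)

record Graph (n : ℕ) : Set₁ where
  field
    E     : Fin n → Fin n → Set
    sym   : ∀ {x y} → E x y → E y x
    irrefl : ∀ {x} → ¬ E x x
    E?    : Decidable E
open Graph public

data Walk {n : ℕ} (G : Graph n) : Fin n → Fin n → Set where
  here : ∀ {x} → Walk G x x
  step : ∀ {x y z} → E G x y → Walk G y z → Walk G x z

Connected : ∀ {n} → Graph n → Set
Connected G = ∀ x y → Walk G x y

HasInducedP4 : ∀ {n} → Graph n → Set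
HasInducedP4 {n} G = Σ (Fin n) λ a → Σ (Fin n) λ b → Σ (Fin n) λ c → Σ (Fin n) λ d →
  (a ≢ b × a ≢ c × a ≢ d × b ≢ c × b ≢ d × c ≢ d) ×
  (E G a b × E G b c × E G c d) ×
  (¬ E G a c × ¬ E G b d × ¬ E G a d)

HasInducedC4 : ∀ {n} → Graph n → Set
HasInducedC4 {n} G = Σ (Fin n) λ a → Σ (Fin n) λ b → Σ (Fin n) λ c → Σ (Fin n) λ d →
  (a ≢ b × a ≢ c × a ≢ d × b ≢ c × b ≢ d × c ≢ d) ×
  (E G a b × E G b c × E G c d × E G d a) ×
  (¬ E G a c × ¬ E G b d)

P4C4Free : ∀ {n} → Graph n → Set
P4C4Free G = ¬ HasInducedP4 G × ¬ HasInducedC4 G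

-- An ordering σ of V(G) is a bijection from vertices to positions;
-- x <σ y iff the position of x is smaller than the position of y.
Ordering : ℕ → Set
Ordering n = Fin n ↔ Fin n

_<[_]_ : ∀ {n} → Fin n → Ordering n → Fin n → Set
x <[ σ ] y = Inverse.to σ x < Inverse.to σ y

IsLexBFS : ∀ {n} → Graph n → Ordering n → Set
IsLexBFS {n} G σ = ∀ a b c → a <[ σ ] b → b <[ σ ] c → E G a c → ¬ E G a b →
  Σ (Fin n) λ d → d <[ σ ] a × E G d b × ¬ E G d c

IsLexDFS : ∀ {n} → Graph n → Ordering n → Set
IsLexDFS {n} G σ = ∀ a b c → a <[ σ ] b → b <[ σ ] c → E G a c → ¬ E G a b →
  Σ (Fin n) λ d → a <[ σ ] d × d <[ σ ] b × E G d b × ¬ E G d c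

IsMNS : ∀ {n} → Graph n → Ordering n → Set
IsMNS {n} G σ = ∀ a b c → a <[ σ ] b → b <[ σ ] c → E G a c → ¬ E G a b →
  Σ (Fin n) λ d → d <[ σ ] b × E G d b × ¬ E G d c

{-# OPTIONS --safe #-}
-- Both directions go through induced paths w – x – y – z whose diagonals wy and xz are
-- missing; such a path is exactly an induced P4 or C4.
--
-- If G has no such path, an MNS ordering has no triple a < b < c with ac ∈ E, ab ∉ E at all,
-- so the LexBFS and LexDFS conditions hold vacuously: for a triple with pos b + pos c minimal,
-- the MNS witness d < b (db ∈ E, dc ∉ E) is not adjacent to a, since otherwise b – d – a – c
-- would be such a path, and then (d, a, b) or (a, d, c) is a smaller triple.
--
-- Conversely, given such a path, run MNS starting with x, y and avoiding w and z as long as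
-- possible. When this gets stuck both w and z may be visited next, x being a visited
-- neighbour of w only and y one of z only. Visiting z next gives x < z < w with xw ∈ E,
-- xz ∉ E and nothing before x, against LexBFS. Against LexDFS, take the last visited vertex a
-- adjacent to exactly one of w and z, and visit the other one next.
module Submission where

open import Data.Empty using (⊥-elim)
open import Data.Fin using (Fin; toℕ; fromℕ<)
open import Data.Fin.Properties using (all?; any?; toℕ-injective; toℕ<n; toℕ-fromℕ<; injective⇒≤)
  renaming (_≟_ to _≟ᶠ_)
open import Data.Nat using (ℕ; zero; suc; _+_; _≤_; _<_; z≤n; s≤s)
open import Data.Nat.Properties
open import Data.Product using (Σ; ∃; _×_; _,_; proj₁; proj₂)
open import Data.Sum using (_⊎_; inj₁; inj₂; [_,_])
open import Data.Unit using (⊤; tt)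
open import Defs
open import Function using (_∘_)
open import Function.Bundles using (Inverse; Equivalence; mk↔ₛ′; _⇔_; mk⇔)
open import Relation.Binary using (tri<; tri≈; tri>)
open import Relation.Binary.PropositionalEquality as ≡ using (_≡_; _≢_; refl; cong; subst)
open import Relation.Nullary using (¬_; Dec; yes; no)
open import Relation.Nullary.Decidable using (_×-dec_; _→-dec_; ¬?; decidable-stable)
open import Relation.Unary using (Decidable)

module _ {P : ℕ → Set} (P? : Decidable P) (p₀ : P 0) where

  last-satisfying-≤ : ∀ k → ∃ λ t → t ≤ k × P t × (∀ {r} → t < r → r ≤ k → ¬ P r)
  last-satisfying-≤ zero = 0 , z≤n , p₀ , λ t<r r≤0 → ⊥-elim (<⇒≱ t<r r≤0)
  last-satisfying-≤ (suc k) with P? (suc k)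
  ... | yes p = suc k , ≤-refl , p , λ k<r r≤k → ⊥-elim (<⇒≱ k<r r≤k)
  ... | no ¬p with last-satisfying-≤ k
  ...   | t , t≤k , pt , none = t , m≤n⇒m≤1+n t≤k , pt , later
    where
    later : ∀ {r} → t < r → r ≤ suc k → ¬ P r
    later t<r r≤k+1 with m≤n⇒m<n∨m≡n r≤k+1
    ... | inj₁ r<k+1 = none t<r (≤-pred r<k+1)
    ... | inj₂ refl = ¬p

  last-satisfying : ∀ {k} → 0 < k → ∃ λ t → t < k × P t × (∀ {r} → t < r → r < k → ¬ P r)
  last-satisfying {suc k} _ with last-satisfying-≤ k
  ... | t , t≤k , pt , none = t , s≤s t≤k , pt , λ t<r r<k+1 → none t<r (≤-pred r<k+1)

module _ {n : ℕ} where

  pos : Ordering n → Fin n → ℕ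
  pos σ v = toℕ (Inverse.to σ v)

  pos-injective : ∀ (σ : Ordering n) {u v} → pos σ u ≡ pos σ v → u ≡ v
  pos-injective σ {u} {v} e = begin
    u                            ≡⟨ ≡.sym (strictlyInverseʳ u) ⟩
    from (Inverse.to σ u)        ≡⟨ cong from (toℕ-injective e) ⟩
    from (Inverse.to σ v)        ≡⟨ strictlyInverseʳ v ⟩
    v                            ∎
    where
    open Inverse σ using (from; strictlyInverseʳ)
    open ≡.≡-Reasoning

  <σ⇒≢ : ∀ {σ : Ordering n} {u v} → u <[ σ ] v → u ≢ v
  <σ⇒≢ u<v refl = <-irrefl refl u<v

module _ {n : ℕ} (G : Graph n) where

  edge⇒≢ : ∀ {u v} → E G u v → u ≢ v
  edge⇒≢ e refl = irrefl G e

  record PathWithoutDiagonals : Set where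
    field
      w x y z : Fin n
      wx : E G w x
      xy : E G x y
      yz : E G y z
      ¬wy : ¬ E G w y
      ¬xz : ¬ E G x z
      w≢y : w ≢ y
      x≢z : x ≢ z

  open PathWithoutDiagonals

  w≢z : (p : PathWithoutDiagonals) → w p ≢ z p
  w≢z p refl = ¬wy p (sym G (yz p))

  pathWithoutDiagonals-distinct : (p : PathWithoutDiagonals) →
    w p ≢ x p × w p ≢ y p × w p ≢ z p × x p ≢ y p × x p ≢ z p × y p ≢ z p
  pathWithoutDiagonals-distinct p =
    edge⇒≢ (wx p) , w≢y p , w≢z p , edge⇒≢ (xy p) , x≢z p , edge⇒≢ (yz p)

  pathWithoutDiagonals⇒P4⊎C4 : PathWithoutDiagonals → HasInducedP4 G ⊎ HasInducedC4 G
  pathWithoutDiagonals⇒P4⊎C4 p with E? G (z p) (w p)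
  ... | yes zw = inj₂ (w p , x p , y p , z p , pathWithoutDiagonals-distinct p ,
                       (wx p , xy p , yz p , zw) , (¬wy p , ¬xz p))
  ... | no ¬zw = inj₁ (w p , x p , y p , z p , pathWithoutDiagonals-distinct p ,
                       (wx p , xy p , yz p) , (¬wy p , ¬xz p , ¬zw ∘ sym G))

  P4⇒pathWithoutDiagonals : HasInducedP4 G → PathWithoutDiagonals
  P4⇒pathWithoutDiagonals (a , b , c , d , (_ , a≢c , _ , _ , b≢d , _) , (ab , bc , cd) , (¬ac , ¬bd , _)) =
    record { w = a ; x = b ; y = c ; z = d ; wx = ab ; xy = bc ; yz = cd
           ; ¬wy = ¬ac ; ¬xz = ¬bd ; w≢y = a≢c ; x≢z = b≢d }

  C4⇒pathWithoutDiagonals : HasInducedC4 G → PathWithoutDiagonals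
  C4⇒pathWithoutDiagonals (a , b , c , d , (_ , a≢c , _ , _ , b≢d , _) , (ab , bc , cd , _) , (¬ac , ¬bd)) =
    record { w = a ; x = b ; y = c ; z = d ; wx = ab ; xy = bc ; yz = cd
           ; ¬wy = ¬ac ; ¬xz = ¬bd ; w≢y = a≢c ; x≢z = b≢d }

  p4c4Free⇔¬pathWithoutDiagonals : P4C4Free G ⇔ (¬ PathWithoutDiagonals)
  p4c4Free⇔¬pathWithoutDiagonals = mk⇔
    (λ free → [ proj₁ free , proj₂ free ] ∘ pathWithoutDiagonals⇒P4⊎C4)
    (λ none → none ∘ P4⇒pathWithoutDiagonals , none ∘ C4⇒pathWithoutDiagonals)

  OpenTriple : Ordering n → Fin n → Fin n → Fin n → Set
  OpenTriple σ a b c = a <[ σ ] b × b <[ σ ] c × E G a c × ¬ E G a b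

  module _ {σ : Ordering n} (noPath : ¬ PathWithoutDiagonals) (mns : IsMNS G σ) where

    mns-witness-¬adjacent : ∀ {a b c d} → OpenTriple σ a b c →
      d <[ σ ] b → E G d b → ¬ E G d c → ¬ E G d a
    mns-witness-¬adjacent (a<b , b<c , ac , ¬ab) d<b db ¬dc da = noPath record
      { w = _ ; x = _ ; y = _ ; z = _ ; wx = sym G db ; xy = da ; yz = ac ; ¬wy = ¬ab ∘ sym G ; ¬xz = ¬dc
      ; w≢y = <σ⇒≢ {σ = σ} a<b ∘ ≡.sym ; x≢z = <σ⇒≢ {σ = σ} (<-trans d<b b<c) }

    ¬openTriple-below : ∀ m {a b c} → pos σ b + pos σ c < m → ¬ OpenTriple σ a b c
    ¬openTriple-below (suc m) {a} {b} {c} bound triple@(a<b , b<c , ac , ¬ab)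
      with mns a b c a<b b<c ac ¬ab
    ... | d , d<b , db , ¬dc with <-cmp (pos σ d) (pos σ a)
    ...   | tri< d<a _ _ = ¬openTriple-below m (<-≤-trans (+-mono-< a<b b<c) (≤-pred bound))
                             (d<a , a<b , db , mns-witness-¬adjacent triple d<b db ¬dc)
    ...   | tri≈ _ d≡a _ = ¬ab (subst (λ v → E G v b) (pos-injective σ d≡a) db)
    ...   | tri> _ _ a<d = ¬openTriple-below m (<-≤-trans (+-monoˡ-< (pos σ c) d<b) (≤-pred bound))
                             (a<d , <-trans d<b b<c , ac , mns-witness-¬adjacent triple d<b db ¬dc ∘ sym G)

    ¬openTriple : ∀ {a b c} → ¬ OpenTriple σ a b c
    ¬openTriple = ¬openTriple-below _ ≤-refl

    ¬path∧mns⇒lexDFS : IsLexDFS G σ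
    ¬path∧mns⇒lexDFS a b c a<b b<c ac ¬ab = ⊥-elim (¬openTriple (a<b , b<c , ac , ¬ab))

    ¬path∧mns⇒lexBFS : IsLexBFS G σ
    ¬path∧mns⇒lexBFS a b c a<b b<c ac ¬ab = ⊥-elim (¬openTriple (a<b , b<c , ac , ¬ab))

-- An MNS ordering is built one vertex at a time: f 0, …, f (k−1) is the visited prefix, and v
-- is Eligible to be visited next if its neighbourhood among visited vertices is not strictly
-- contained in that of another unvisited vertex.
module Construction {n : ℕ} (G : Graph n) where

  Seq : Set
  Seq = ℕ → Fin n

  Unvisited : Seq → ℕ → Fin n → Set
  Unvisited f k v = ∀ {t} → t < k → f t ≢ v

  NbhdSub : Seq → ℕ → Fin n → Fin n → Set
  NbhdSub f k u v = ∀ {t} → t < k → E G (f t) u → E G (f t) v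

  StrictNbhdSub : Seq → ℕ → Fin n → Fin n → Set
  StrictNbhdSub f k u v = NbhdSub f k u v × ∃ λ t → t < k × E G (f t) v × ¬ E G (f t) u

  Maximal : Seq → ℕ → Fin n → Set
  Maximal f k v = ∀ u → Unvisited f k u → ¬ StrictNbhdSub f k v u

  Eligible : Seq → ℕ → Fin n → Set
  Eligible f k v = Unvisited f k v × Maximal f k v

  Fresh : Seq → ℕ → Set
  Fresh f k = ∀ {j} → j < k → Unvisited f j (f j)

  IsMNSPrefix : Seq → ℕ → Set
  IsMNSPrefix f k = ∀ {j} → j < k → Eligible f j (f j)

  unvisited? : ∀ f k v → Dec (Unvisited f k v)
  unvisited? f k v = allUpTo? (λ t → ¬? (f t ≟ᶠ v)) k

  nbhdSub? : ∀ f k u v → Dec (NbhdSub f k u v)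
  nbhdSub? f k u v = allUpTo? (λ t → E? G (f t) u →-dec E? G (f t) v) k

  strictNbhdSub? : ∀ f k u v → Dec (StrictNbhdSub f k u v)
  strictNbhdSub? f k u v = nbhdSub? f k u v ×-dec anyUpTo? (λ t → E? G (f t) v ×-dec ¬? (E? G (f t) u)) k

  eligible? : ∀ f k v → Dec (Eligible f k v)
  eligible? f k v = unvisited? f k v ×-dec all? (λ u → unvisited? f k u →-dec ¬? (strictNbhdSub? f k v u))

  ¬nbhdSub⇒separated : ∀ {f k u v} → ¬ NbhdSub f k u v → ∃ λ t → t < k × E G (f t) u × ¬ E G (f t) v
  ¬nbhdSub⇒separated {f} {k} {u} {v} ¬sub with anyUpTo? (λ t → E? G (f t) u ×-dec ¬? (E? G (f t) v)) k
  ... | yes separated = separated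
  ... | no ¬separated =
    ⊥-elim (¬sub λ {t} t<k tu → decidable-stable (E? G (f t) v) λ ¬tv → ¬separated (t , t<k , tu , ¬tv))

  maximal⇒separated : ∀ {f k u v t} → Maximal f k v → Unvisited f k u →
    t < k → E G (f t) u → ¬ E G (f t) v → ∃ λ s → s < k × E G (f s) v × ¬ E G (f s) u
  maximal⇒separated max unu t<k tu ¬tv = ¬nbhdSub⇒separated λ sub → max _ unu (sub , _ , t<k , tu , ¬tv)

  maximal⊎strictlyDominated : ∀ f k v → Maximal f k v ⊎ ∃ λ u → Unvisited f k u × StrictNbhdSub f k v u
  maximal⊎strictlyDominated f k v with any? (λ u → unvisited? f k u ×-dec strictNbhdSub? f k v u)
  ... | yes dominated = inj₂ dominated
  ... | no ¬dominated = inj₁ λ u unu strict → ¬dominated (u , unu , strict)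

  visitedDegree : Seq → ℕ → Fin n → ℕ
  visitedDegree f zero v = 0
  visitedDegree f (suc k) v with E? G (f k) v
  ... | yes _ = suc (visitedDegree f k v)
  ... | no _ = visitedDegree f k v

  visitedDegree≤ : ∀ f k v → visitedDegree f k v ≤ k
  visitedDegree≤ f zero v = z≤n
  visitedDegree≤ f (suc k) v with E? G (f k) v
  ... | yes _ = s≤s (visitedDegree≤ f k v)
  ... | no _ = m≤n⇒m≤1+n (visitedDegree≤ f k v)

  nbhdSub-pred : ∀ {f k u v} → NbhdSub f (suc k) u v → NbhdSub f k u v
  nbhdSub-pred sub t<k = sub (m<n⇒m<1+n t<k)

  visitedDegree-mono : ∀ f k {u v} → NbhdSub f k u v → visitedDegree f k u ≤ visitedDegree f k v
  visitedDegree-mono f zero sub = z≤n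
  visitedDegree-mono f (suc k) {u} {v} sub with E? G (f k) u | E? G (f k) v
  ... | yes _  | yes _  = s≤s (visitedDegree-mono f k (nbhdSub-pred sub))
  ... | yes ku | no ¬kv = ⊥-elim (¬kv (sub ≤-refl ku))
  ... | no _   | yes _  = m≤n⇒m≤1+n (visitedDegree-mono f k (nbhdSub-pred sub))
  ... | no _   | no _   = visitedDegree-mono f k (nbhdSub-pred sub)

  visitedDegree-strict : ∀ f k {u v} → StrictNbhdSub f k u v → visitedDegree f k u < visitedDegree f k v
  visitedDegree-strict f (suc k) {u} {v} (sub , t , t<k+1 , tv , ¬tu)
    with E? G (f k) u | E? G (f k) v | m<1+n⇒m<n∨m≡n t<k+1
  ... | yes ku | no ¬kv | _         = ⊥-elim (¬kv (sub ≤-refl ku))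
  ... | yes ku | yes _  | inj₂ refl = ⊥-elim (¬tu ku)
  ... | no _   | no ¬kv | inj₂ refl = ⊥-elim (¬kv tv)
  ... | no _   | yes _  | _         = s≤s (visitedDegree-mono f k (nbhdSub-pred sub))
  ... | yes _  | yes _  | inj₁ t<k  = s≤s (visitedDegree-strict f k (nbhdSub-pred sub , t , t<k , tv , ¬tu))
  ... | no _   | no _   | inj₁ t<k  = visitedDegree-strict f k (nbhdSub-pred sub , t , t<k , tv , ¬tu)

  -- Climbing along strict inclusions raises the visited degree, which is bounded by k.
  eligible-above-bounded : ∀ f k d {u} → k ≤ d + visitedDegree f k u → Unvisited f k u →
    ∃ λ m → Eligible f k m × NbhdSub f k u m
  eligible-above-bounded f k d {u} bound unu with maximal⊎strictlyDominated f k u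
  ... | inj₁ max = u , (unu , max) , λ _ tu → tu
  ... | inj₂ (v , unv , strict@(sub , _)) = climb d bound
    where
    deg< : visitedDegree f k u < visitedDegree f k v
    deg< = visitedDegree-strict f k strict
    climb : ∀ d → k ≤ d + visitedDegree f k u → ∃ λ m → Eligible f k m × NbhdSub f k u m
    climb zero bound = ⊥-elim (<-irrefl refl (<-≤-trans (≤-<-trans bound deg<) (visitedDegree≤ f k v)))
    climb (suc d) bound with eligible-above-bounded f k d {v}
                               (≤-trans bound (≤-trans (≤-reflexive (≡.sym (+-suc d _))) (+-monoʳ-≤ d deg<))) unv
    ... | m , elm , subm = m , elm , λ t<k tu → subm t<k (sub t<k tu)

  eligible-above : ∀ {f k u} → Unvisited f k u → ∃ λ m → Eligible f k m × NbhdSub f k u m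
  eligible-above {f} {k} = eligible-above-bounded f k k (m≤m+n k _)

  eligible-if-only-rival : ∀ {f k u u′ t} → Unvisited f k u → (∀ {m} → Eligible f k m → m ≡ u ⊎ m ≡ u′) →
    t < k → E G (f t) u → ¬ E G (f t) u′ → Eligible f k u
  eligible-if-only-rival unu onlyRival t<k tu ¬tu′ with eligible-above unu
  ... | m , elm , subm with onlyRival elm
  ...   | inj₁ refl = elm
  ...   | inj₂ refl = ⊥-elim (¬tu′ (subm t<k tu))

  Agree : Seq → Seq → ℕ → Set
  Agree f g k = ∀ {t} → t < k → f t ≡ g t

  agree-sym : ∀ {f g k} → Agree f g k → Agree g f k
  agree-sym fg t<k = ≡.sym (fg t<k)

  agree-≤ : ∀ {f g j k} → j ≤ k → Agree f g k → Agree f g j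
  agree-≤ j≤k fg t<j = fg (<-≤-trans t<j j≤k)

  unvisited-cong : ∀ {f g k v} → Agree f g k → Unvisited f k v → Unvisited g k v
  unvisited-cong fg unv t<k gt≡v = unv t<k (≡.trans (fg t<k) gt≡v)

  nbhdSub-cong : ∀ {f g k u v} → Agree f g k → NbhdSub f k u v → NbhdSub g k u v
  nbhdSub-cong fg sub t<k rewrite ≡.sym (fg t<k) = sub t<k

  strictNbhdSub-cong : ∀ {f g k u v} → Agree f g k → StrictNbhdSub f k u v → StrictNbhdSub g k u v
  strictNbhdSub-cong {u = u} {v} fg (sub , t , t<k , tv , ¬tu) =
    nbhdSub-cong fg sub , t , t<k , subst (λ a → E G a v) (fg t<k) tv , ¬tu ∘ subst (λ a → E G a u) (≡.sym (fg t<k))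

  eligible-cong : ∀ {f g k v} → Agree f g k → Eligible f k v → Eligible g k v
  eligible-cong fg (unv , max) = unvisited-cong fg unv ,
    λ u unu strict → max u (unvisited-cong (agree-sym fg) unu) (strictNbhdSub-cong (agree-sym fg) strict)

  snoc : Seq → ℕ → Fin n → Seq
  snoc f k v t with t ≟ k
  ... | yes _ = v
  ... | no _ = f t

  snoc-last : ∀ f k v → snoc f k v k ≡ v
  snoc-last f k v with k ≟ k
  ... | yes _ = refl
  ... | no k≢k = ⊥-elim (k≢k refl)

  snoc-agree : ∀ f k v → Agree (snoc f k v) f k
  snoc-agree f k v {t} t<k with t ≟ k
  ... | yes refl = ⊥-elim (<-irrefl refl t<k)
  ... | no _ = refl

  snoc-stepwise : (Q : Seq → ℕ → Fin n → Set) → (∀ {f g j v} → Agree f g j → Q f j v → Q g j v) →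
    ∀ {f k v} → (∀ {j} → j < k → Q f j (f j)) → Q f k v →
    ∀ {j} → j < suc k → Q (snoc f k v) j (snoc f k v j)
  snoc-stepwise Q Q-cong {f} {k} {v} before now {j} j<k+1 with m<1+n⇒m<n∨m≡n j<k+1
  ... | inj₁ j<k = subst (Q _ j) (≡.sym (snoc-agree f k v j<k))
                     (Q-cong (agree-≤ (<⇒≤ j<k) (agree-sym (snoc-agree f k v))) (before j<k))
  ... | inj₂ refl = subst (Q _ k) (≡.sym (snoc-last f k v)) (Q-cong (agree-sym (snoc-agree f k v)) now)

  fresh⇒injective : ∀ {f k s t} → Fresh f k → s < k → t < k → f s ≡ f t → s ≡ t
  fresh⇒injective {s = s} {t} fresh s<k t<k fs≡ft with <-cmp s t
  ... | tri< s<t _ _ = ⊥-elim (fresh t<k s<t fs≡ft)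
  ... | tri≈ _ s≡t _ = s≡t
  ... | tri> _ _ t<s = ⊥-elim (fresh s<k t<s (≡.sym fs≡ft))

  fresh⇒≤ : ∀ {f k} → Fresh f k → k ≤ n
  fresh⇒≤ {f} {k} fresh = injective⇒≤ {f = λ (i : Fin k) → f (toℕ i)}
    λ e → toℕ-injective (fresh⇒injective fresh (toℕ<n _) (toℕ<n _) e)

  isMNSPrefix⇒fresh : ∀ {f k} → IsMNSPrefix f k → Fresh f k
  isMNSPrefix⇒fresh pre j<k = proj₁ (pre j<k)

  unvisited⇒< : ∀ {f k v} → IsMNSPrefix f k → Unvisited f k v → k < n
  unvisited⇒< pre unv = fresh⇒≤ (snoc-stepwise Unvisited unvisited-cong (isMNSPrefix⇒fresh pre) unv)

  record Prefix : Set where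
    field
      seq : Seq
      len : ℕ
      isMNSPrefix : IsMNSPrefix seq len

  open Prefix

  extend : ∀ (s : Prefix) {v} → Eligible (seq s) (len s) v → Prefix
  extend s {v} elv = record
    { seq = snoc (seq s) (len s) v
    ; len = suc (len s)
    ; isMNSPrefix = snoc-stepwise Eligible eligible-cong (isMNSPrefix s) elv
    }

  _⊑_ : Prefix → Prefix → Set
  s ⊑ s′ = len s ≤ len s′ × Agree (seq s′) (seq s) (len s)

  ⊑-refl : ∀ {s} → s ⊑ s
  ⊑-refl = ≤-refl , λ _ → refl

  ⊑-trans : ∀ {s s′ s″} → s ⊑ s′ → s′ ⊑ s″ → s ⊑ s″
  ⊑-trans (≤₁ , agree₁) (≤₂ , agree₂) = ≤-trans ≤₁ ≤₂ , λ t<k → ≡.trans (agree₂ (<-≤-trans t<k ≤₁)) (agree₁ t<k)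

  ⊑-extend : ∀ {s v} (elv : Eligible (seq s) (len s) v) → s ⊑ extend s elv
  ⊑-extend {s} {v} _ = n≤1+n _ , snoc-agree (seq s) (len s) v

  record GreedyRun (P : Fin n → Set) (s : Prefix) : Set where
    field
      final : Prefix
      extends : s ⊑ final
      added : ∀ {t} → len s ≤ t → t < len final → P (seq final t)
      stuck : ∀ {v} → P v → ¬ Eligible (seq final) (len final) v

  abstract
    greedy : ∀ {P} → Decidable P → ∀ fuel s → n ≤ fuel + len s → GreedyRun P s
    greedy {P} P? fuel s bound with any? (λ v → P? v ×-dec eligible? (seq s) (len s) v)
    ... | no none = record
      { final = s ; extends = ⊑-refl {s} ; added = λ s≤t t<s → ⊥-elim (≤⇒≯ s≤t t<s)
      ; stuck = λ pv elv → none (_ , pv , elv) }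
    greedy P? zero s bound | yes (v , _ , elv) = ⊥-elim (<⇒≱ (unvisited⇒< (isMNSPrefix s) (proj₁ elv)) bound)
    greedy {P} P? (suc fuel) s bound | yes (v , pv , elv) = record
      { final = final
      ; extends = ⊑-trans {s} {extend s elv} {final} (⊑-extend {s} elv) extends
      ; added = added′
      ; stuck = stuck
      }
      where
      open GreedyRun (greedy P? fuel (extend s elv) (≤-trans bound (≤-reflexive (≡.sym (+-suc fuel (len s))))))
      added′ : ∀ {t} → len s ≤ t → t < len final → P (seq final t)
      added′ s≤t t<final with m≤n⇒m<n∨m≡n s≤t
      ... | inj₁ s<t = added s<t t<final
      ... | inj₂ refl = subst P (≡.sym (≡.trans (proj₂ extends ≤-refl) (snoc-last (seq s) (len s) v))) pv

  Complete : Prefix → Set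
  Complete s = ∀ v → ∃ λ t → t < len s × seq s t ≡ v

  completion : ∀ s → Σ Prefix λ s′ → s ⊑ s′ × Complete s′
  completion s = final , extends , visited
    where
    open GreedyRun (greedy {P = λ _ → ⊤} (λ _ → yes tt) n s (m≤m+n n _))
    visited : Complete final
    visited v with anyUpTo? (λ t → seq final t ≟ᶠ v) (len final)
    ... | yes found = found
    ... | no ¬found with eligible-above {u = v} (λ t<k ft≡v → ¬found (_ , t<k , ft≡v))
    ...   | _ , elm , _ = ⊥-elim (stuck tt elm)

  Extends : Ordering n → Prefix → Set
  Extends σ s = ∀ {t} → t < len s → pos σ (seq s t) ≡ t

  extends-visited : ∀ {σ s d} → Extends σ s → pos σ d < len s → seq s (pos σ d) ≡ d
  extends-visited {σ} ext d<k = pos-injective σ (ext d<k)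

  extends-unvisited : ∀ {σ s c} → Extends σ s → Unvisited (seq s) (len s) c → len s ≤ pos σ c
  extends-unvisited {σ} {s} ext unc = ≮⇒≥ λ c<k → unc c<k (extends-visited {σ} {s} ext c<k)

  ⊑-extends : ∀ {σ s s′} → s ⊑ s′ → Extends σ s′ → Extends σ s
  ⊑-extends {σ} (≤′ , agree) ext t<k = ≡.trans (cong (pos σ) (≡.sym (agree t<k))) (ext (<-≤-trans t<k ≤′))

  module CompleteOrdering (s : Prefix) (complete : Complete s) where

    private
      f : Seq
      f = seq s
      k : ℕ
      k = len s

    position : Fin n → ℕ
    position v = proj₁ (complete v)

    position<k : ∀ v → position v < k
    position<k v = proj₁ (proj₂ (complete v))

    seq-position : ∀ v → f (position v) ≡ v
    seq-position v = proj₂ (proj₂ (complete v))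

    position-seq : ∀ {t} → t < k → position (f t) ≡ t
    position-seq t<k = fresh⇒injective (isMNSPrefix⇒fresh (isMNSPrefix s)) (position<k _) t<k (seq-position _)

    n≤k : n ≤ k
    n≤k = injective⇒≤ {f = λ v → fromℕ< (position<k v)} λ {u} {v} e → begin
      u                 ≡⟨ ≡.sym (seq-position u) ⟩
      f (position u)    ≡⟨ cong f (≡.trans (≡.sym (toℕ-fromℕ< _)) (≡.trans (cong toℕ e) (toℕ-fromℕ< _))) ⟩
      f (position v)    ≡⟨ seq-position v ⟩
      v                 ∎
      where open ≡.≡-Reasoning

    k≤n : k ≤ n
    k≤n = fresh⇒≤ (isMNSPrefix⇒fresh (isMNSPrefix s))

    σ : Ordering n
    σ = mk↔ₛ′ (λ v → fromℕ< (<-≤-trans (position<k v) k≤n)) (f ∘ toℕ)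
      (λ i → toℕ-injective (≡.trans (toℕ-fromℕ< _) (position-seq (<-≤-trans (toℕ<n i) n≤k))))
      (λ v → ≡.trans (cong f (toℕ-fromℕ< _)) (seq-position v))

    pos≡position : ∀ v → pos σ v ≡ position v
    pos≡position v = toℕ-fromℕ< _

    extends : Extends σ s
    extends t<k = ≡.trans (pos≡position _) (position-seq t<k)

    pos<k : ∀ v → pos σ v < k
    pos<k v = subst (_< k) (≡.sym (pos≡position v)) (position<k v)

    seq-pos : ∀ v → f (pos σ v) ≡ v
    seq-pos v = extends-visited {σ} {s} extends (pos<k v)

    -- The MNS condition for b is the maximality of b at the moment it was visited.
    mns : IsMNS G σ
    mns a b c a<b b<c ac ¬ab
      with maximal⇒separated maxb unc a<b (subst (λ v → E G v c) (≡.sym (seq-pos a)) ac)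
                                          (subst (λ v → ¬ E G v b) (≡.sym (seq-pos a)) ¬ab)
      where
      maxb : Maximal f (pos σ b) b
      maxb = subst (Maximal f (pos σ b)) (seq-pos b) (proj₂ (isMNSPrefix s (pos<k b)))
      unc : Unvisited f (pos σ b) c
      unc t<b ft≡c =
        <-asym b<c (subst (_< pos σ b) (≡.trans (≡.sym (extends (<-trans t<b (pos<k b)))) (cong (pos σ) ft≡c)) t<b)
    ... | t , t<b , tb , ¬tc = f t , subst (_< pos σ b) (≡.sym (extends (<-trans t<b (pos<k b)))) t<b , tb , ¬tc

  abstract
    mnsOrdering : ∀ s → Σ (Ordering n) λ σ → IsMNS G σ × Extends σ s
    mnsOrdering s with completion s
    ... | s′ , s⊑s′ , complete = σ , mns , ⊑-extends {σ} {s} {s′} s⊑s′ extends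
      where open CompleteOrdering s′ complete

  module Visiting (s : Prefix) {b c : Fin n} (elb : Eligible (seq s) (len s) b)
                  (unc : Unvisited (seq s) (len s) c) (c≢b : c ≢ b) where

    private
      s⁺ : Prefix
      s⁺ = extend s elb
      ordering : Σ (Ordering n) λ σ → IsMNS G σ × Extends σ s⁺
      ordering = mnsOrdering s⁺
      extends⁺ : Extends (proj₁ ordering) s⁺
      extends⁺ = proj₂ (proj₂ ordering)

    σ : Ordering n
    σ = proj₁ ordering

    mns : IsMNS G σ
    mns = proj₁ (proj₂ ordering)

    extends : Extends σ s
    extends = ⊑-extends {σ} {s} {s⁺} (⊑-extend {s} elb) extends⁺

    pos-b : pos σ b ≡ len s
    pos-b = ≡.trans (cong (pos σ) (≡.sym (snoc-last (seq s) (len s) b))) (extends⁺ ≤-refl)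

    visited<b : ∀ {t} → t < len s → seq s t <[ σ ] b
    visited<b t<k = ≡.subst₂ _<_ (≡.sym (extends t<k)) (≡.sym pos-b) t<k

    b<c : b <[ σ ] c
    b<c = subst (_< pos σ c) (≡.sym pos-b) (extends-unvisited {σ} {s⁺} extends⁺ unc⁺)
      where
      unc⁺ : Unvisited (seq s⁺) (len s⁺) c
      unc⁺ t<k+1 with m<1+n⇒m<n∨m≡n t<k+1
      ... | inj₁ t<k = unc t<k ∘ ≡.trans (≡.sym (snoc-agree (seq s) (len s) b t<k))
      ... | inj₂ refl = λ e → c≢b (≡.trans (≡.sym e) (snoc-last (seq s) (len s) b))

    ¬lexBFS : 0 < len s → E G (seq s 0) c → ¬ E G (seq s 0) b → ¬ IsLexBFS G σ
    ¬lexBFS 0<k ac ¬ab lexBFS with lexBFS (seq s 0) b c (visited<b 0<k) b<c ac ¬ab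
    ... | d , d<a , _ = n≮0 (subst (pos σ d <_) (extends 0<k) d<a)

    ¬lexDFS : ∀ {t} → t < len s → E G (seq s t) c → ¬ E G (seq s t) b →
      (∀ {r} → t < r → r < len s → E G (seq s r) b → E G (seq s r) c) → ¬ IsLexDFS G σ
    ¬lexDFS {t} t<k ac ¬ab later lexDFS with lexDFS (seq s t) b c (visited<b t<k) b<c ac ¬ab
    ... | d , a<d , d<b , db , ¬dc =
      ¬dc (subst (λ v → E G v c) fd (later t<d d<k (subst (λ v → E G v b) (≡.sym fd) db)))
      where
      d<k : pos σ d < len s
      d<k = subst (pos σ d <_) pos-b d<b
      fd : seq s (pos σ d) ≡ d
      fd = extends-visited {σ} {s} extends d<k
      t<d : t < pos σ d
      t<d = subst (_< pos σ d) (extends t<k) a<d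

module Counterexample {n : ℕ} {G : Graph n} (p : PathWithoutDiagonals G) where
  open PathWithoutDiagonals p
  open Construction G
  open Prefix

  start : Prefix
  start = record { seq = xThenY ; len = 2 ; isMNSPrefix = isMNSPrefix-xThenY }
    where
    xThenY : Seq
    xThenY zero = x
    xThenY (suc _) = y
    isMNSPrefix-xThenY : IsMNSPrefix xThenY 2
    isMNSPrefix-xThenY {zero} _ = (λ ()) , λ { _ _ (_ , _ , () , _) }
    isMNSPrefix-xThenY {suc zero} _ =
      (λ { {zero} _ → edge⇒≢ G xy ; {suc _} (s≤s ()) })
      , λ { _ _ (_ , zero , _ , _ , ¬xy) → ¬xy xy ; _ _ (_ , suc _ , s≤s () , _) }
    isMNSPrefix-xThenY {suc (suc _)} (s≤s (s≤s ()))

  AvoidsWZ : Fin n → Set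
  AvoidsWZ v = v ≢ w × v ≢ z

  open GreedyRun (greedy {P = AvoidsWZ} (λ v → ¬? (v ≟ᶠ w) ×-dec ¬? (v ≟ᶠ z)) n start (m≤m+n n 2))

  private
    f : Seq
    f = seq final
    k : ℕ
    k = len final

  f0≡x : f 0 ≡ x
  f0≡x = proj₂ extends (s≤s z≤n)

  f1≡y : f 1 ≡ y
  f1≡y = proj₂ extends (s≤s (s≤s z≤n))

  1<k : 1 < k
  1<k = proj₁ extends

  0<k : 0 < k
  0<k = <-trans (s≤s z≤n) 1<k

  x-adjacent-w-only : E G (f 0) w × ¬ E G (f 0) z
  x-adjacent-w-only rewrite f0≡x = sym G wx , ¬xz

  y-adjacent-z-only : E G (f 1) z × ¬ E G (f 1) w
  y-adjacent-z-only rewrite f1≡y = yz , ¬wy ∘ sym G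

  unvisited-if-avoided : ∀ {v} → x ≢ v → y ≢ v → (∀ {u} → AvoidsWZ u → u ≢ v) → Unvisited f k v
  unvisited-if-avoided x≢v y≢v avoided {zero} _ = x≢v ∘ ≡.trans (≡.sym f0≡x)
  unvisited-if-avoided x≢v y≢v avoided {suc zero} _ = y≢v ∘ ≡.trans (≡.sym f1≡y)
  unvisited-if-avoided x≢v y≢v avoided {suc (suc t)} t<k = avoided (added (s≤s (s≤s z≤n)) t<k)

  w-unvisited : Unvisited f k w
  w-unvisited = unvisited-if-avoided (edge⇒≢ G wx ∘ ≡.sym) (w≢y ∘ ≡.sym) proj₁

  z-unvisited : Unvisited f k z
  z-unvisited = unvisited-if-avoided x≢z (edge⇒≢ G yz) proj₂

  eligible⇒w⊎z : ∀ {m} → Eligible f k m → m ≡ w ⊎ m ≡ z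
  eligible⇒w⊎z {m} elm with m ≟ᶠ w | m ≟ᶠ z
  ... | yes m≡w | _ = inj₁ m≡w
  ... | no _ | yes m≡z = inj₂ m≡z
  ... | no m≢w | no m≢z = ⊥-elim (stuck (m≢w , m≢z) elm)

  w-eligible : Eligible f k w
  w-eligible = eligible-if-only-rival w-unvisited eligible⇒w⊎z 0<k
    (proj₁ x-adjacent-w-only) (proj₂ x-adjacent-w-only)

  z-eligible : Eligible f k z
  z-eligible = eligible-if-only-rival z-unvisited ([ inj₂ , inj₁ ] ∘ eligible⇒w⊎z) 1<k
    (proj₁ y-adjacent-z-only) (proj₂ y-adjacent-z-only)

  ¬allLexBFS : ¬ (∀ σ → IsMNS G σ → IsLexBFS G σ)
  ¬allLexBFS allLexBFS =
    ¬lexBFS 0<k (proj₁ x-adjacent-w-only) (proj₂ x-adjacent-w-only) (allLexBFS σ mns)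
    where open Visiting final z-eligible w-unvisited (w≢z G p)

  OneSided : Fin n → Set
  OneSided v = (E G v w × ¬ E G v z) ⊎ (E G v z × ¬ E G v w)

  oneSided? : ∀ v → Dec (OneSided v)
  oneSided? v with E? G v w | E? G v z
  ... | yes vw | yes vz = no λ { (inj₁ (_ , ¬vz)) → ¬vz vz ; (inj₂ (_ , ¬vw)) → ¬vw vw }
  ... | yes vw | no ¬vz = yes (inj₁ (vw , ¬vz))
  ... | no ¬vw | yes vz = yes (inj₂ (vz , ¬vw))
  ... | no ¬vw | no ¬vz = no λ { (inj₁ (vw , _)) → ¬vw vw ; (inj₂ (vz , _)) → ¬vz vz }

  ¬allLexDFS : ¬ (∀ σ → IsMNS G σ → IsLexDFS G σ)
  ¬allLexDFS allLexDFS with last-satisfying (oneSided? ∘ f) (inj₁ x-adjacent-w-only) 0<k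
  ... | t , t<k , inj₁ (tw , ¬tz) , twoSidedAfter =
    ¬lexDFS t<k tw ¬tz
      (λ t<r r<k rz → decidable-stable (E? G _ w) λ ¬rw → twoSidedAfter t<r r<k (inj₂ (rz , ¬rw)))
      (allLexDFS σ mns)
    where open Visiting final z-eligible w-unvisited (w≢z G p)
  ... | t , t<k , inj₂ (tz , ¬tw) , twoSidedAfter =
    ¬lexDFS t<k tz ¬tw
      (λ t<r r<k rw → decidable-stable (E? G _ z) λ ¬rz → twoSidedAfter t<r r<k (inj₁ (rw , ¬rz)))
      (allLexDFS σ mns)
    where open Visiting final w-eligible z-unvisited (w≢z G p ∘ ≡.sym)

theorem3 : ∀ {n : ℕ} (G : Graph n) → Connected G →
    ((P4C4Free G ⇔ (∀ σ → IsMNS G σ → IsLexDFS G σ)) ×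
     (P4C4Free G ⇔ (∀ σ → IsMNS G σ → IsLexBFS G σ)))
theorem3 G _ =
  mk⇔ (λ free σ → ¬path∧mns⇒lexDFS G {σ} (to free))
      (λ allLexDFS → from λ p → Counterexample.¬allLexDFS p allLexDFS) ,
  mk⇔ (λ free σ → ¬path∧mns⇒lexBFS G {σ} (to free))
      (λ allLexBFS → from λ p → Counterexample.¬allLexBFS p allLexBFS)
  where open Equivalence (p4c4Free⇔¬pathWithoutDiagonals G)
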